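{- Let $k\ge 3$, let $G=K_{k+1}$, and let $L$ be a $k$-assignment for $G$. If there exist $v,w\in V(G)$ with $L(v)\neq L(w)$, then $G$ is $L$-swappable.
   Context: A list-assignment $L$ assigns to each vertex $v$ a set $L(v)$ of colors; a $k$-assignment has $|L(v)|=k$ for all $v$. An $L$-coloring is a proper coloring $\varphi$ with $\varphi(v)\in L(v)$. An $\alpha,\beta$-Kempe swap at $u$ (with $\varphi(u)\in\{\alpha,\beta\}$) interchanges $\alpha$ and $\beta$ on the component containing $u$ of the subgraph induced by vertices colored $\alpha$ or $\beta$; it is $L$-valid if the result is again an $L$-coloring. Two $L$-colorings are $L$-equivalent if one is obtained from the other by a sequence of $L$-valid Kempe swaps. $G$ is $L$-swappable if it has an $L$-coloring and all its $L$-colorings are pairwise $L$-equivalent. -}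

module Defs where

open import Data.Nat using (ℕ; suc)
open import Data.Fin using (Fin)
open import Data.List using (List; length)
open import Data.List.Membership.Propositional using (_∈_)
open import Data.List.Relation.Unary.Unique.Propositional using (Unique)
open import Data.Product using (Σ; ∃; _×_; _,_)
open import Data.Sum using (_⊎_)
open import Relation.Nullary using (¬_)
open import Relation.Binary.PropositionalEquality using (_≡_; _≢_)
open import Relation.Binary.Construct.Closure.ReflexiveTransitive using (Star)
open import Function.Bundles using (_⇔_)

-- A graph on vertex set Fin n, given by its (symmetric, irreflexive) adjacency relation.
Graph : ℕ → Set₁
Graph n = Fin n → Fin n → Set

Complete : (n : ℕ) → Graph n
Complete n u v = u ≢ v

-- Colours are natural numbers; a list assignment gives each vertex a list of colours,
-- read as a set.
Colour : Set
Colour = ℕ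

ListAssignment : ℕ → Set
ListAssignment n = Fin n → List Colour

IsKAssignment : ∀ {n} → ℕ → ListAssignment n → Set
IsKAssignment k L = ∀ v → Unique (L v) × length (L v) ≡ k

SameSet : List Colour → List Colour → Set
SameSet A B = ∀ c → (c ∈ A) ⇔ (c ∈ B)

Colouring : ℕ → Set
Colouring n = Fin n → Colour

Proper : ∀ {n} → Graph n → Colouring n → Set
Proper G φ = ∀ u v → G u v → φ u ≢ φ v

IsLColouring : ∀ {n} → Graph n → ListAssignment n → Colouring n → Set
IsLColouring G L φ = Proper G φ × (∀ v → φ v ∈ L v)

InAB : ∀ {n} → Colouring n → Colour → Colour → Fin n → Set
InAB φ α β v = φ v ≡ α ⊎ φ v ≡ β

-- Reach G φ α β u v : v lies in the component containing u of the subgraph of G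
-- induced by vertices coloured α or β.
data Reach {n} (G : Graph n) (φ : Colouring n) (α β : Colour) (u : Fin n) : Fin n → Set where
  here : InAB φ α β u → Reach G φ α β u u
  step : ∀ {v w} → Reach G φ α β u v → G v w → InAB φ α β w → Reach G φ α β u w

KempeSwap : ∀ {n} → Graph n → Colouring n → Colour → Colour → Fin n → Colouring n → Set
KempeSwap G φ α β u ψ =
  InAB φ α β u ×
  (∀ v → (Reach G φ α β u v →
            (φ v ≡ α × ψ v ≡ β) ⊎ (φ v ≡ β × ψ v ≡ α))
       × (¬ Reach G φ α β u v → ψ v ≡ φ v))

LValidSwap : ∀ {n} → Graph n → ListAssignment n → Colouring n → Colouring n → Set
LValidSwap G L φ ψ =
  IsLColouring G L φ × IsLColouring G L ψ ×
  Σ Colour λ α → Σ Colour λ β → Σ (Fin _) λ u → KempeSwap G φ α β u ψ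

LEquivalent : ∀ {n} → Graph n → ListAssignment n → Colouring n → Colouring n → Set
LEquivalent G L = Star (LValidSwap G L)

LSwappable : ∀ {n} → Graph n → ListAssignment n → Set
LSwappable G L =
  (∃ λ φ → IsLColouring G L φ) ×
  (∀ φ ψ → IsLColouring G L φ → IsLColouring G L ψ → LEquivalent G L φ ψ)

module Submission where

-- On a complete graph every L-colouring is injective, so the α,β-component of a vertex has at
-- most two vertices and an L-valid Kempe swap either recolours one vertex with an unused colour of
-- its list or exchanges the colours of two vertices. For a degree-assignment (|L v| ≥ n − 1) on Kₙ
-- any two colourings φ, ψ are joined by such moves, by induction on n: if at most two moves make φ
-- agree with ψ at some vertex x, delete x and the colour ψ x and recurse. Otherwise every vertex is
-- blocked, which makes x ↦ (the vertex holding ψ x) a derangement σ with L (σ x) the set of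
-- colours φ uses off x; for n ≥ 4 two exchanges still produce an agreement, while for n = 3 this is
-- a genuine exception. When a reduction of K₄ lands on such a blocked triangle, the deleted colour
-- lies in all other lists, and this gives a detour to agreement at a vertex whose own reduction is
-- not blocked. Different lists L v ≠ L w are needed only for a first colouring: give v a colour
-- missing from L w and colour greedily with w last.

open import Defs
open import Data.Empty using (⊥; ⊥-elim)
open import Data.Fin using (Fin; zero; suc; punchIn; punchOut)
open import Data.Fin.Permutation.Components using (transpose; transpose-inverse)
open import Data.Fin.Properties
  using (_≟_; any?; all?; ¬∀⟶∃¬; injective⇒≤; punchOut-injective; punchIn-injective; punchInᵢ≢i; punchIn-punchOut)
open import Data.List using (List; []; _∷_; length; _++_; allFin; tabulate; filter; map)
open import Data.List.Properties using (length-++-sucʳ; length-tabulate; filter-notAll)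
open import Data.List.Membership.Propositional using (_∈_; _∉_; find)
open import Data.List.Membership.Propositional.Properties
  using (∈-∃++; ∈-++⁻; ∈-++⁺ˡ; ∈-++⁺ʳ; ∈-allFin; ∈-filter⁺; ∈-filter⁻; ∈-tabulate⁺; ∈-map⁺)
import Data.List.Membership.DecPropositional as DecMembership
open import Data.List.Relation.Binary.Subset.Propositional using (_⊆_)
open import Data.List.Relation.Unary.Any as Any using (here; there)
open import Data.List.Relation.Unary.All as All using (All; []; _∷_)
open import Data.List.Relation.Unary.All.Properties using (¬All⇒Any¬)
open import Data.List.Relation.Unary.AllPairs using ([]; _∷_)
open import Data.List.Relation.Unary.Unique.Propositional using (Unique)
open import Data.List.Relation.Unary.Unique.Propositional.Properties using (allFin⁺; filter⁺)
open import Data.Nat as ℕ using (ℕ; zero; suc; _≤_; _<_; z≤n; s≤s)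
open import Data.Nat.Properties using (≤-trans; ≤-reflexive; ≤-pred; <⇒≱; 1+n≰n)
open import Data.Product using (Σ; ∃; ∃₂; _×_; _,_; proj₁; proj₂)
open import Data.Sum using (_⊎_; inj₁; inj₂; [_,_])
open import Data.Vec.Functional using (updateAt; insertAt; removeAt)
open import Data.Vec.Functional.Properties
  using (updateAt-updates; updateAt-minimal; insertAt-lookup; insertAt-punchIn; insertAt-removeAt)
open import Function using (_∘_; const)
open import Function.Bundles using (mk⇔)
open import Function.Definitions using (Injective)
open import Relation.Binary.Construct.Closure.ReflexiveTransitive using (Star; ε; _◅_; _◅◅_)
open import Relation.Binary.PropositionalEquality hiding ([_])
open import Relation.Nullary using (¬_; ¬?; Dec; yes; no; contradiction)
open import Relation.Nullary.Decidable using (_×-dec_)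

open ≡-Reasoning
open DecMembership ℕ._≟_ using (_∈?_)

module _ {A : Set} where

  mutual
    ⊆⇒length≤ : {xs ys : List A} → Unique xs → xs ⊆ ys → length xs ≤ length ys
    ⊆⇒length≤ {[]}     _              _     = z≤n
    ⊆⇒length≤ {x ∷ xs} (x∉xs ∷ uxs) x∷xs⊆ys =
      ⊆-∌⇒length< uxs (x∷xs⊆ys ∘ there) (x∷xs⊆ys (here refl)) (λ x∈xs → All.lookup x∉xs x∈xs refl)

    ⊆-∌⇒length< : {xs ys : List A} {e : A} → Unique xs → xs ⊆ ys → e ∈ ys → e ∉ xs →
                  length xs < length ys
    ⊆-∌⇒length< {xs} {e = e} uxs xs⊆ys e∈ys e∉xs with as , bs , refl ← ∈-∃++ e∈ys =
      ≤-trans (s≤s (⊆⇒length≤ uxs xs⊆as++bs)) (≤-reflexive (sym (length-++-sucʳ as e bs)))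
      where
      xs⊆as++bs : xs ⊆ as ++ bs
      xs⊆as++bs x∈xs with ∈-++⁻ as (xs⊆ys x∈xs)
      ... | inj₁ x∈as          = ∈-++⁺ˡ x∈as
      ... | inj₂ (here refl)   = contradiction x∈xs e∉xs
      ... | inj₂ (there x∈bs)  = ∈-++⁺ʳ as x∈bs

module _ {n : ℕ} where
  open DecMembership (_≟_ {n}) using () renaming (_∈?_ to _∈ᶠ?_)

  private
    |allFin| : length (allFin n) ≡ n
    |allFin| = length-tabulate (λ i → i)

  Unique⇒length≤ : {as : List (Fin n)} → Unique as → length as ≤ n
  Unique⇒length≤ {as} uas = subst (length as ≤_) |allFin| (⊆⇒length≤ uas (λ {a} _ → ∈-allFin a))

  ∃-∉ : (as : List (Fin n)) → length as < n → ∃ λ y → y ∉ as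
  ∃-∉ as |as|<n with all? (_∈ᶠ? as)
  ... | yes all∈ = contradiction (subst (_≤ length as) |allFin| (⊆⇒length≤ (allFin⁺ n) (λ {y} _ → all∈ y))) (<⇒≱ |as|<n)
  ... | no ¬all∈ = ¬∀⟶∃¬ n (_∈ as) (_∈ᶠ? as) ¬all∈

injective⇒surjective : ∀ {n} {f : Fin n → Fin n} → Injective _≡_ _≡_ f → ∀ v → ∃ λ t → f t ≡ v
injective⇒surjective {suc m} {f} f-inj v with any? (λ t → f t ≟ v)
... | yes found = found
... | no ∄t = contradiction (injective⇒≤ avoid-injective) 1+n≰n
  where
  v≢f : ∀ t → v ≢ f t
  v≢f t v≡ft = ∄t (t , sym v≡ft)
  avoid : Fin (suc m) → Fin m
  avoid t = punchOut (v≢f t)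
  avoid-injective : Injective _≡_ _≡_ avoid
  avoid-injective {s} {t} eq = f-inj (punchOut-injective (v≢f s) (v≢f t) eq)

∃-∈ : ∀ {A : Set} {xs : List A} → 0 < length xs → ∃ (_∈ xs)
∃-∈ {xs = x ∷ _} _ = x , here refl

∀⊎⇒⊎∀ : ∀ {n} {A : Set} {B : Fin n → Set} → (∀ x → A ⊎ B x) → A ⊎ (∀ x → B x)
∀⊎⇒⊎∀ {zero}          h = inj₂ λ ()
∀⊎⇒⊎∀ {suc n} {B = B} h with h zero | ∀⊎⇒⊎∀ {B = B ∘ suc} (h ∘ suc)
... | inj₁ a  | _        = inj₁ a
... | inj₂ _  | inj₁ a   = inj₁ a
... | inj₂ b₀ | inj₂ bₛ  = inj₂ λ { zero → b₀ ; (suc x) → bₛ x }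

Uses : ∀ {n} → Colouring n → Colour → Set
Uses φ e = ∃ λ w → φ w ≡ e

uses? : ∀ {n} (φ : Colouring n) e → Dec (Uses φ e)
uses? φ e = any? (λ w → φ w ℕ.≟ e)

module _ {n : ℕ} where

  IsColouring : ListAssignment n → Colouring n → Set
  IsColouring = IsLColouring (Complete n)

  proper⇒injective : ∀ {φ} → Proper (Complete n) φ → Injective _≡_ _≡_ φ
  proper⇒injective {φ} proper {u} {v} φu≡φv with u ≟ v
  ... | yes u≡v = u≡v
  ... | no  u≢v = contradiction φu≡φv (proper u v u≢v)

  injective⇒proper : ∀ {φ} → Injective _≡_ _≡_ φ → Proper (Complete n) φ
  injective⇒proper injective u v u≢v = u≢v ∘ injective

  colouring-injective : ∀ {L φ} → IsColouring L φ → Injective _≡_ _≡_ φ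
  colouring-injective = proper⇒injective ∘ proj₁

module _ {n : ℕ} (L : ListAssignment n) where

  data Move (φ ψ : Colouring n) : Set where
    recolour : ∀ v → ψ v ∈ L v → ¬ Uses φ (ψ v) → (∀ w → w ≢ v → ψ w ≡ φ w) → Move φ ψ
    exchange : ∀ u v → u ≢ v → φ u ∈ L v → φ v ∈ L u → ψ u ≡ φ v → ψ v ≡ φ u →
               (∀ w → w ≢ u → w ≢ v → ψ w ≡ φ w) → Move φ ψ
    stay     : (∀ w → ψ w ≡ φ w) → Move φ ψ

  Path : Colouring n → Colouring n → Set
  Path = Star Move

  move-colouring : ∀ {φ ψ} → IsColouring L φ → Move φ ψ → IsColouring L ψ
  move-colouring {φ} {ψ} cφ (recolour v ψv∈Lv fresh unchanged) = injective⇒proper ψ-injective , ψ∈L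
    where
    ψ-injective : Injective _≡_ _≡_ ψ
    ψ-injective {a} {b} ψa≡ψb with a ≟ v | b ≟ v
    ... | yes refl | yes refl = refl
    ... | yes refl | no b≢v   = contradiction (b , trans (sym (unchanged b b≢v)) (sym ψa≡ψb)) fresh
    ... | no a≢v   | yes refl = contradiction (a , trans (sym (unchanged a a≢v)) ψa≡ψb) fresh
    ... | no a≢v   | no b≢v   =
      colouring-injective cφ (trans (sym (unchanged a a≢v)) (trans ψa≡ψb (unchanged b b≢v)))
    ψ∈L : ∀ w → ψ w ∈ L w
    ψ∈L w with w ≟ v
    ... | yes refl = ψv∈Lv
    ... | no w≢v   = subst (_∈ L w) (sym (unchanged w w≢v)) (proj₂ cφ w)
  move-colouring {φ} {ψ} cφ (exchange u v _ φu∈Lv φv∈Lu ψu≡φv ψv≡φu unchanged) =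
    injective⇒proper ψ-injective , ψ∈L
    where
    ψ≗φ∘transpose : ∀ w → ψ w ≡ φ (transpose u v w)
    ψ≗φ∘transpose w with w ≟ u
    ... | yes refl = ψu≡φv
    ... | no w≢u with w ≟ v
    ... | yes refl = ψv≡φu
    ... | no w≢v   = unchanged w w≢u w≢v
    ψ-injective : Injective _≡_ _≡_ ψ
    ψ-injective {a} {b} ψa≡ψb = begin
      a                               ≡⟨ transpose-inverse v u ⟨
      transpose v u (transpose u v a) ≡⟨ cong (transpose v u) (colouring-injective cφ φτa≡φτb) ⟩
      transpose v u (transpose u v b) ≡⟨ transpose-inverse v u ⟩
      b                               ∎
      where
      φτa≡φτb : φ (transpose u v a) ≡ φ (transpose u v b)
      φτa≡φτb = trans (sym (ψ≗φ∘transpose a)) (trans ψa≡ψb (ψ≗φ∘transpose b))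
    ψ∈L : ∀ w → ψ w ∈ L w
    ψ∈L w with w ≟ u
    ... | yes refl = subst (_∈ L u) (sym ψu≡φv) φv∈Lu
    ... | no w≢u with w ≟ v
    ... | yes refl = subst (_∈ L v) (sym ψv≡φu) φu∈Lv
    ... | no w≢v   = subst (_∈ L w) (sym (unchanged w w≢u w≢v)) (proj₂ cφ w)
  move-colouring cφ (stay ψ≗φ) =
    injective⇒proper (λ ψa≡ψb → colouring-injective cφ (trans (sym (ψ≗φ _)) (trans ψa≡ψb (ψ≗φ _)))) ,
    λ w → subst (_∈ L w) (sym (ψ≗φ w)) (proj₂ cφ w)

  path-colouring : ∀ {φ ψ} → IsColouring L φ → Path φ ψ → IsColouring L ψ
  path-colouring cφ ε        = cφ
  path-colouring cφ (m ◅ ms) = path-colouring (move-colouring cφ m) ms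

  private
    reach-InAB : ∀ {φ α β u w} → Reach (Complete n) φ α β u w → InAB φ α β w
    reach-InAB (here u∈αβ)     = u∈αβ
    reach-InAB (step _ _ w∈αβ) = w∈αβ

  KempeStep : Colouring n → Colouring n → Set
  KempeStep φ ψ = Σ Colour λ α → Σ Colour λ β → Σ (Fin n) λ u → KempeSwap (Complete n) φ α β u ψ

  -- `stay` (needed because pointwise-equal colourings need not be equal without function
  -- extensionality) is realised by the trivial φ z,φ z-swap.
  move⇒kempe : ∀ {φ ψ} → Injective _≡_ _≡_ φ → Fin n → Move φ ψ → KempeStep φ ψ
  move⇒kempe {φ} {ψ} φ-inj _ (recolour v _ fresh unchanged) =
    φ v , ψ v , v , inj₁ refl , λ w → inside w , outside w
    where
    inside : ∀ w → Reach (Complete n) φ (φ v) (ψ v) v w →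
             (φ w ≡ φ v × ψ w ≡ ψ v) ⊎ (φ w ≡ ψ v × ψ w ≡ φ v)
    inside w r with reach-InAB r
    ... | inj₁ φw≡φv with refl ← φ-inj φw≡φv = inj₁ (refl , refl)
    ... | inj₂ φw≡ψv = contradiction (w , φw≡ψv) fresh
    outside : ∀ w → ¬ Reach (Complete n) φ (φ v) (ψ v) v w → ψ w ≡ φ w
    outside w ¬r with w ≟ v
    ... | yes refl = contradiction (here (inj₁ refl)) ¬r
    ... | no w≢v   = unchanged w w≢v
  move⇒kempe {φ} {ψ} φ-inj _ (exchange u v u≢v _ _ ψu≡φv ψv≡φu unchanged) =
    φ u , φ v , u , inj₁ refl , λ w → inside w , outside w
    where
    inside : ∀ w → Reach (Complete n) φ (φ u) (φ v) u w →
             (φ w ≡ φ u × ψ w ≡ φ v) ⊎ (φ w ≡ φ v × ψ w ≡ φ u)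
    inside w r with reach-InAB r
    ... | inj₁ φw≡φu with refl ← φ-inj φw≡φu = inj₁ (refl , ψu≡φv)
    ... | inj₂ φw≡φv with refl ← φ-inj φw≡φv = inj₂ (refl , ψv≡φu)
    outside : ∀ w → ¬ Reach (Complete n) φ (φ u) (φ v) u w → ψ w ≡ φ w
    outside w ¬r with w ≟ u | w ≟ v
    ... | yes refl | _        = contradiction (here (inj₁ refl)) ¬r
    ... | no _     | yes refl = contradiction (step (here (inj₁ refl)) u≢v (inj₂ refl)) ¬r
    ... | no w≢u   | no w≢v   = unchanged w w≢u w≢v
  move⇒kempe {φ} {ψ} φ-inj z (stay ψ≗φ) =
    φ z , φ z , z , inj₁ refl , λ w → inside w , λ _ → ψ≗φ w
    where
    inside : ∀ w → Reach (Complete n) φ (φ z) (φ z) z w →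
             (φ w ≡ φ z × ψ w ≡ φ z) ⊎ (φ w ≡ φ z × ψ w ≡ φ z)
    inside w r with reach-InAB r
    ... | inj₁ φw≡φz with refl ← φ-inj φw≡φz = inj₁ (refl , ψ≗φ z)
    ... | inj₂ φw≡φz with refl ← φ-inj φw≡φz = inj₁ (refl , ψ≗φ z)

  path⇒LEquivalent : Fin n → ∀ {φ ψ} → IsColouring L φ → Path φ ψ → LEquivalent (Complete n) L φ ψ
  path⇒LEquivalent z cφ ε        = ε
  path⇒LEquivalent z cφ (m ◅ ms) =
    (cφ , move-colouring cφ m , move⇒kempe (colouring-injective cφ) z m) ◅ path⇒LEquivalent z (move-colouring cφ m) ms

infixl 9 _[_≔_] _[_⇄_]

_[_≔_] : ∀ {n} → Colouring n → Fin n → Colour → Colouring n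
φ [ v ≔ d ] = updateAt φ v (const d)

_[_⇄_] : ∀ {n} → Colouring n → Fin n → Fin n → Colouring n
φ [ u ⇄ v ] = φ [ u ≔ φ v ] [ v ≔ φ u ]

≔-here : ∀ {n} {φ : Colouring n} v {d} → (φ [ v ≔ d ]) v ≡ d
≔-here {φ = φ} v = updateAt-updates v φ

≔-elsewhere : ∀ {n} {φ : Colouring n} {v d} w → w ≢ v → (φ [ v ≔ d ]) w ≡ φ w
≔-elsewhere {φ = φ} {v} w w≢v = updateAt-minimal w v φ w≢v

⇄-left : ∀ {n} {φ : Colouring n} {u v} → u ≢ v → (φ [ u ⇄ v ]) u ≡ φ v
⇄-left {u = u} u≢v = trans (≔-elsewhere u u≢v) (≔-here u)

⇄-right : ∀ {n} {φ : Colouring n} u v → (φ [ u ⇄ v ]) v ≡ φ u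
⇄-right u v = ≔-here v

⇄-elsewhere : ∀ {n} {φ : Colouring n} {u v} w → w ≢ u → w ≢ v → (φ [ u ⇄ v ]) w ≡ φ w
⇄-elsewhere w w≢u w≢v = trans (≔-elsewhere w w≢v) (≔-elsewhere w w≢u)

vacated-fresh : ∀ {n} {φ : Colouring n} {e} → Injective _≡_ _≡_ φ → ¬ Uses φ e → ∀ u → ¬ Uses (φ [ u ≔ e ]) (φ u)
vacated-fresh {φ = φ} φ-inj e-fresh u (w , eq) with w ≟ u
... | yes refl = e-fresh (u , trans (sym eq) (≔-here u))
... | no w≢u   = w≢u (φ-inj (trans (sym (≔-elsewhere w w≢u)) eq))

module _ {n : ℕ} (L : ListAssignment n) {φ : Colouring n} where

  recolouring : ∀ v {d} → d ∈ L v → ¬ Uses φ d → Move L φ (φ [ v ≔ d ])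
  recolouring v d∈Lv fresh =
    recolour v (subst (_∈ L v) (sym (≔-here v)) d∈Lv) (subst (¬_ ∘ Uses φ) (sym (≔-here v)) fresh) ≔-elsewhere

  exchanging : ∀ {u v} → u ≢ v → φ u ∈ L v → φ v ∈ L u → Move L φ (φ [ u ⇄ v ])
  exchanging {u} {v} u≢v φu∈Lv φv∈Lu = exchange u v u≢v φu∈Lv φv∈Lu (⇄-left u≢v) (⇄-right u v) ⇄-elsewhere

infixl 6 _∖_

_∖_ : List Colour → Colour → List Colour
xs ∖ c = filter (λ e → ¬? (e ℕ.≟ c)) xs

∈-∖⁻ : ∀ xs {c e} → e ∈ xs ∖ c → e ∈ xs × e ≢ c
∈-∖⁻ xs {c} = ∈-filter⁻ (λ e → ¬? (e ℕ.≟ c)) {xs = xs}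

module _ {xs : List Colour} {c : Colour} where

  ∈-∖⁺ : ∀ {e} → e ∈ xs → e ≢ c → e ∈ xs ∖ c
  ∈-∖⁺ = ∈-filter⁺ (λ e → ¬? (e ℕ.≟ c))

  ∖-unique : Unique xs → Unique (xs ∖ c)
  ∖-unique = filter⁺ (λ e → ¬? (e ℕ.≟ c))

  ∖-length : Unique xs → length xs ≤ suc (length (xs ∖ c))
  ∖-length uxs = ⊆⇒length≤ uxs xs⊆c∷xs∖c
    where
    xs⊆c∷xs∖c : xs ⊆ c ∷ xs ∖ c
    xs⊆c∷xs∖c {e} e∈xs with e ℕ.≟ c
    ... | yes refl = here refl
    ... | no e≢c   = there (∈-∖⁺ e∈xs e≢c)

  ∖-length< : c ∈ xs → length (xs ∖ c) < length xs
  ∖-length< c∈xs = filter-notAll (λ e → ¬? (e ℕ.≟ c)) xs (Any.map (λ c≡e e≢c → e≢c (sym c≡e)) c∈xs)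

  ∉⇒⊆∖ : c ∉ xs → xs ⊆ xs ∖ c
  ∉⇒⊆∖ c∉xs e∈xs = ∈-∖⁺ e∈xs λ { refl → c∉xs e∈xs }

-- |L v| ≥ n − 1 = deg v in Kₙ, stated without truncated subtraction.
IsDegreeAssignment : ∀ {n} → ListAssignment n → Set
IsDegreeAssignment {n} L = ∀ v → Unique (L v) × n ≤ suc (length (L v))

data Around {m} (x : Fin (suc m)) : Fin (suc m) → Set where
  centre  : Around x x
  punched : ∀ i → Around x (punchIn x i)

around : ∀ {m} (x w : Fin (suc m)) → Around x w
around x w with w ≟ x
... | yes refl = centre
... | no w≢x   = subst (Around x) (punchIn-punchOut (w≢x ∘ sym)) (punched _)

module Deletion {m : ℕ} (L : ListAssignment (suc m)) (x : Fin (suc m)) (c : Colour) where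

  L⁻ : ListAssignment m
  L⁻ i = L (punchIn x i) ∖ c

  restrict : Colouring (suc m) → Colouring m
  restrict φ = removeAt φ x

  ∈-L⁻ : ∀ {i e} → e ∈ L⁻ i → e ∈ L (punchIn x i) × e ≢ c
  ∈-L⁻ {i} = ∈-∖⁻ (L (punchIn x i))

  extend : Colouring m → Colouring (suc m)
  extend χ = insertAt χ x c

  extend-centre : ∀ χ → extend χ x ≡ c
  extend-centre χ = insertAt-lookup χ x c

  extend-punched : ∀ χ i → extend χ (punchIn x i) ≡ χ i
  extend-punched χ = insertAt-punchIn χ x c

  extend-restrict : ∀ {φ} → φ x ≡ c → ∀ w → extend (restrict φ) w ≡ φ w
  extend-restrict {φ} φx≡c w = subst (λ d → insertAt (removeAt φ x) x d w ≡ φ w) φx≡c (insertAt-removeAt φ x w)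

  degree-assignment : IsDegreeAssignment L → IsDegreeAssignment L⁻
  degree-assignment deg i = ∖-unique (proj₁ (deg v)) , ≤-trans (≤-pred (proj₂ (deg v))) (∖-length (proj₁ (deg v)))
    where
    v : Fin (suc m)
    v = punchIn x i

  restrict-colouring : ∀ {φ} → IsColouring L φ → φ x ≡ c → IsColouring L⁻ (restrict φ)
  restrict-colouring {φ} cφ φx≡c =
    injective⇒proper (punchIn-injective x _ _ ∘ colouring-injective cφ) ,
    λ i → ∈-∖⁺ (proj₂ cφ (punchIn x i)) (λ φi≡c → punchInᵢ≢i x i (colouring-injective cφ (trans φi≡c (sym φx≡c))))

  extend-colouring : c ∈ L x → ∀ {χ} → IsColouring L⁻ χ → IsColouring L (extend χ)
  extend-colouring c∈Lx {χ} cχ = injective⇒proper extend-injective , extend∈L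
    where
    extend∈L : ∀ w → extend χ w ∈ L w
    extend∈L w with around x w
    ... | centre    = subst (_∈ L x) (sym (extend-centre χ)) c∈Lx
    ... | punched i = subst (_∈ L (punchIn x i)) (sym (extend-punched χ i)) (proj₁ (∈-L⁻ (proj₂ cχ i)))
    χ≢c : ∀ i → χ i ≢ c
    χ≢c i = proj₂ (∈-L⁻ (proj₂ cχ i))
    extend-injective : Injective _≡_ _≡_ (extend χ)
    extend-injective {a} {b} eq with around x a | around x b
    ... | centre    | centre    = refl
    ... | centre    | punched j = contradiction (trans (sym (extend-punched χ j)) (trans (sym eq) (extend-centre χ))) (χ≢c j)
    ... | punched i | centre    = contradiction (trans (sym (extend-punched χ i)) (trans eq (extend-centre χ))) (χ≢c i)
    ... | punched i | punched j =
      cong (punchIn x) (colouring-injective cχ (trans (sym (extend-punched χ i)) (trans eq (extend-punched χ j))))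

  extend-≗ : ∀ {χ χ′} w → (∀ i → w ≡ punchIn x i → χ′ i ≡ χ i) → extend χ′ w ≡ extend χ w
  extend-≗ {χ} {χ′} w agree with around x w
  ... | centre    = trans (extend-centre χ′) (sym (extend-centre χ))
  ... | punched i = trans (extend-punched χ′ i) (trans (agree i refl) (sym (extend-punched χ i)))

  extend-move : ∀ {χ χ′} → Move L⁻ χ χ′ → Move L (extend χ) (extend χ′)
  extend-move {χ} {χ′} (recolour v χ′v∈L⁻v fresh unchanged) =
    recolour (punchIn x v) (subst (_∈ L (punchIn x v)) (sym (extend-punched χ′ v)) (proj₁ (∈-L⁻ χ′v∈L⁻v)))
      fresh′ (λ w w≢v → extend-≗ w (λ i w≡ → unchanged i (λ i≡v → w≢v (trans w≡ (cong (punchIn x) i≡v)))))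
    where
    fresh′ : ¬ Uses (extend χ) (extend χ′ (punchIn x v))
    fresh′ (w , eq) with around x w
    ... | centre    = proj₂ (∈-L⁻ χ′v∈L⁻v) (trans (sym (extend-punched χ′ v)) (trans (sym eq) (extend-centre χ)))
    ... | punched i = fresh (i , trans (sym (extend-punched χ i)) (trans eq (extend-punched χ′ v)))
  extend-move {χ} {χ′} (exchange u v u≢v χu∈L⁻v χv∈L⁻u χ′u≡χv χ′v≡χu unchanged) =
    exchange (punchIn x u) (punchIn x v) (u≢v ∘ punchIn-injective x u v)
      (subst (_∈ L (punchIn x v)) (sym (extend-punched χ u)) (proj₁ (∈-L⁻ χu∈L⁻v)))
      (subst (_∈ L (punchIn x u)) (sym (extend-punched χ v)) (proj₁ (∈-L⁻ χv∈L⁻u)))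
      (trans (extend-punched χ′ u) (trans χ′u≡χv (sym (extend-punched χ v))))
      (trans (extend-punched χ′ v) (trans χ′v≡χu (sym (extend-punched χ u))))
      (λ w w≢u w≢v → extend-≗ w (λ i w≡ →
        unchanged i (λ i≡u → w≢u (trans w≡ (cong (punchIn x) i≡u))) (λ i≡v → w≢v (trans w≡ (cong (punchIn x) i≡v)))))
  extend-move (stay χ′≗χ) = stay (λ w → extend-≗ w (λ i _ → χ′≗χ i))

  extend-path : ∀ {χ χ′} → Path L⁻ χ χ′ → Path L (extend χ) (extend χ′)
  extend-path ε        = ε
  extend-path (m ◅ ms) = extend-move m ◅ extend-path ms

  path-via-deletion : ∀ {φ ψ} → φ x ≡ c → ψ x ≡ c → Path L⁻ (restrict φ) (restrict ψ) → Path L φ ψ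
  path-via-deletion φx≡c ψx≡c p =
    stay (extend-restrict φx≡c) ◅ extend-path p ◅◅ stay (sym ∘ extend-restrict ψx≡c) ◅ ε

module _ {n : ℕ} (L : ListAssignment n) (φ ψ : Colouring n) where

  record Agreement : Set where
    constructor agreement
    field
      vertex   : Fin n
      {target} : Colouring n
      path     : Path L φ target
      agrees   : target vertex ≡ ψ vertex

  -- ψ x cannot be brought to x within two moves: its holder can neither exchange with x nor
  -- escape to a free colour of its list.
  record BlockedAt (x : Fin n) : Set where
    field
      differs    : φ x ≢ ψ x
      holder     : Fin n
      holds      : φ holder ≡ ψ x
      not-listed : φ x ∉ L holder
      all-used   : All (Uses φ) (L holder)

  Blocked : Set
  Blocked = ∀ x → BlockedAt x

module _ {n : ℕ} {L : ListAssignment n} {φ ψ : Colouring n} (cφ : IsColouring L φ) (cψ : IsColouring L ψ) where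

  agreement-or-blockedAt : ∀ x → Agreement L φ ψ ⊎ BlockedAt L φ ψ x
  agreement-or-blockedAt x with φ x ℕ.≟ ψ x
  ... | yes φx≡ψx = inj₁ (agreement x ε φx≡ψx)
  ... | no φx≢ψx with uses? φ (ψ x)
  ... | no ψx-fresh = inj₁ (agreement x (recolouring L x (proj₂ cψ x) ψx-fresh ◅ ε) (≔-here x))
  ... | yes (u , φu≡ψx) with φ x ∈? L u
  ... | yes φx∈Lu = inj₁ (agreement x (exchanging L x≢u φx∈Lu φu∈Lx ◅ ε) (trans (⇄-left x≢u) φu≡ψx))
    where
    x≢u : x ≢ u
    x≢u refl = φx≢ψx φu≡ψx
    φu∈Lx : φ u ∈ L x
    φu∈Lx = subst (_∈ L x) (sym φu≡ψx) (proj₂ cψ x)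
  ... | no φx∉Lu with All.all? (uses? φ) (L u)
  ... | yes all-used = inj₂ (record
    { differs = φx≢ψx ; holder = u ; holds = φu≡ψx ; not-listed = φx∉Lu ; all-used = all-used })
  ... | no ¬all-used with e , e∈Lu , e-fresh ← find (¬All⇒Any¬ (uses? φ) (L u) ¬all-used) =
    inj₁ (agreement x (recolouring L u e∈Lu e-fresh ◅ recolouring L x (proj₂ cψ x) ψx-fresh ◅ ε) (≔-here x))
    where
    ψx-fresh : ¬ Uses (φ [ u ≔ e ]) (ψ x)
    ψx-fresh = subst (¬_ ∘ Uses (φ [ u ≔ e ])) φu≡ψx (vacated-fresh (colouring-injective cφ) e-fresh u)

  agreement-or-blocked : Agreement L φ ψ ⊎ Blocked L φ ψ
  agreement-or-blocked = ∀⊎⇒⊎∀ agreement-or-blockedAt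

-- Every colour of L (σ x) is used by φ at a vertex other than x; for a degree-assignment these
-- n − 1 colours are then exactly the list.
module BlockedAnalysis {n : ℕ} {L : ListAssignment n} (deg : IsDegreeAssignment L) {φ ψ : Colouring n}
                       (cφ : IsColouring L φ) (cψ : IsColouring L ψ) (blocked : Blocked L φ ψ) where

  open BlockedAt

  σ : Fin n → Fin n
  σ x = holder (blocked x)

  σ-holds : ∀ x → φ (σ x) ≡ ψ x
  σ-holds x = holds (blocked x)

  σ-not-listed : ∀ x → φ x ∉ L (σ x)
  σ-not-listed x = not-listed (blocked x)

  σ-injective : Injective _≡_ _≡_ σ
  σ-injective {a} {b} σa≡σb = colouring-injective cψ (trans (sym (σ-holds a)) (trans (cong φ σa≡σb) (σ-holds b)))

  σ-surjective : ∀ v → ∃ λ t → σ t ≡ v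
  σ-surjective = injective⇒surjective σ-injective

  σ-no-fixpoint : ∀ x → σ x ≢ x
  σ-no-fixpoint x σx≡x = differs (blocked x) (trans (cong φ (sym σx≡x)) (σ-holds x))

  σ²-no-fixpoint : ∀ x → σ (σ x) ≢ x
  σ²-no-fixpoint x σσx≡x = σ-not-listed x (subst (_∈ L (σ x)) φσσx≡φx (proj₂ cψ (σ x)))
    where
    φσσx≡φx : ψ (σ x) ≡ φ x
    φσσx≡φx = trans (sym (σ-holds (σ x))) (cong φ σσx≡x)

  3≤n : Fin n → 3 ≤ n
  3≤n x = Unique⇒length≤ {as = x ∷ σ x ∷ σ (σ x) ∷ []}
    (((σ-no-fixpoint x ∘ sym) ∷ (σ²-no-fixpoint x ∘ sym) ∷ []) ∷ ((σ-no-fixpoint (σ x) ∘ sym) ∷ []) ∷ [] ∷ [])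

  private
    listed⊆image : ∀ x → L (σ x) ⊆ tabulate φ
    listed⊆image x e∈L with w , refl ← All.lookup (all-used (blocked x)) e∈L = ∈-tabulate⁺ w

  list-short : ∀ v → length (L v) < n
  list-short v with t , refl ← σ-surjective v = ≤-trans
    (⊆-∌⇒length< (proj₁ (deg (σ t))) (listed⊆image t) (∈-tabulate⁺ t) (σ-not-listed t))
    (≤-reflexive (length-tabulate φ))

  list-tight : ∀ {y z} → z ≢ y → φ z ∈ L (σ y)
  list-tight {y} {z} z≢y with φ z ∈? L (σ y)
  ... | yes φz∈L = φz∈L
  ... | no  φz∉L = contradiction (proj₂ (deg (σ y))) (<⇒≱ (≤-trans (s≤s shorter-than-rest) rest-short))
    where
    rest : List Colour
    rest = tabulate φ ∖ φ y
    shorter-than-rest : length (L (σ y)) < length rest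
    shorter-than-rest = ⊆-∌⇒length< (proj₁ (deg (σ y)))
      (λ e∈L → ∈-∖⁺ (listed⊆image y e∈L) λ { refl → σ-not-listed y e∈L })
      (∈-∖⁺ (∈-tabulate⁺ z) (z≢y ∘ colouring-injective cφ)) φz∉L
    rest-short : length rest < n
    rest-short = ≤-trans (∖-length< (∈-tabulate⁺ y)) (≤-reflexive (length-tabulate φ))

  agreement-from-blocked : 4 ≤ n → Fin n → Agreement L φ ψ
  agreement-from-blocked 4≤n x with σ-surjective x
  ... | t , σt≡x with ∃-∉ (x ∷ σ x ∷ t ∷ []) 4≤n
  ... | y , y∉ =
    agreement x (exchanging L σx≢w (list-tight σx≢y) (list-tight w≢x) ◅ exchanging L x≢w φ₁x∈Lw φ₁w∈Lx ◅ ε)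
      (trans (⇄-left x≢w) (trans (⇄-right (σ x) w) (σ-holds x)))
    where
    w : Fin n
    w = σ y
    x≢y : x ≢ y
    x≢y x≡y = y∉ (here (sym x≡y))
    σx≢y : σ x ≢ y
    σx≢y σx≡y = y∉ (there (here (sym σx≡y)))
    w≢x : w ≢ x
    w≢x w≡x = y∉ (there (there (here (σ-injective (trans w≡x (sym σt≡x))))))
    x≢w : x ≢ w
    x≢w = w≢x ∘ sym
    σx≢w : σ x ≢ w
    σx≢w = x≢y ∘ σ-injective
    φ₁ : Colouring n
    φ₁ = φ [ σ x ⇄ w ]
    φ₁x∈Lw : φ₁ x ∈ L w
    φ₁x∈Lw = subst (_∈ L w) (sym (⇄-elsewhere x (σ-no-fixpoint x ∘ sym) x≢w)) (list-tight x≢y)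
    φ₁w∈Lx : φ₁ w ∈ L x
    φ₁w∈Lx = subst (_∈ L x) (sym (trans (⇄-right (σ x) w) (σ-holds x))) (proj₂ cψ x)

-- The blocked triangle is a genuine exception: lists {1,2}, {2,3}, {3,1} with φ = (1,2,3) and
-- ψ = (2,3,1): φ admits no move other than staying put.
Connectivity : ℕ → Set
Connectivity n = (L : ListAssignment n) → IsDegreeAssignment L → ∀ {φ ψ} → IsColouring L φ → IsColouring L ψ →
                 Path L φ ψ ⊎ (n ≡ 3 × Blocked L φ ψ)

module Reduction {m : ℕ} {L : ListAssignment (suc m)} (deg : IsDegreeAssignment L) {φ ψ : Colouring (suc m)}
                 (cφ : IsColouring L φ) (cψ : IsColouring L ψ) (x : Fin (suc m)) (φx≡ψx : φ x ≡ ψ x) where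

  open Deletion L x (ψ x) public

  deg⁻ : IsDegreeAssignment L⁻
  deg⁻ = degree-assignment deg

  cφ⁻ : IsColouring L⁻ (restrict φ)
  cφ⁻ = restrict-colouring cφ φx≡ψx

  cψ⁻ : IsColouring L⁻ (restrict ψ)
  cψ⁻ = restrict-colouring cψ refl

  lift : Path L⁻ (restrict φ) (restrict ψ) → Path L φ ψ
  lift = path-via-deletion φx≡ψx refl

module TriangleCase (connect₃ : Connectivity 3) {L : ListAssignment 4} (deg : IsDegreeAssignment L)
                    {φ ψ : Colouring 4} (cφ : IsColouring L φ) (cψ : IsColouring L ψ)
                    (x : Fin 4) (φx≡ψx : φ x ≡ ψ x)
                    (blocked⁻ : Blocked (Deletion.L⁻ L x (ψ x)) (removeAt φ x) (removeAt ψ x)) where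

  c : Colour
  c = ψ x
  open Reduction deg cφ cψ x φx≡ψx
  open BlockedAnalysis deg⁻ cφ⁻ cψ⁻ blocked⁻

  list-long : ∀ {v xs} → L v ⊆ xs → 3 ≤ length xs
  list-long {v} Lv⊆xs = ≤-trans (≤-pred (proj₂ (deg v))) (⊆⇒length≤ (proj₁ (deg v)) Lv⊆xs)

  c-listed : ∀ i → c ∈ L (punchIn x i)
  c-listed i with c ∈? L (punchIn x i)
  ... | yes c∈L = c∈L
  ... | no  c∉L = contradiction (list-long (∉⇒⊆∖ c∉L)) (<⇒≱ (list-short i))

  module _ (i : Fin 3) {φ′ : Colouring 4} (p : Path L φ φ′) (φ′Y≡ψY : φ′ (punchIn x i) ≡ ψ (punchIn x i)) where

    private
      Y : Fin 4
      Y = punchIn x i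
      module AtY = Reduction deg (path-colouring L cφ p) cψ Y φ′Y≡ψY

    finish-at : Path L φ ψ
    finish-at with connect₃ AtY.L⁻ AtY.deg⁻ AtY.cφ⁻ AtY.cψ⁻
    ... | inj₁ p⁻ = p ◅◅ AtY.lift p⁻
    ... | inj₂ (_ , blockedAtY) =
      contradiction (list-long Lz⊆) (<⇒≱ (BlockedAnalysis.list-short AtY.deg⁻ AtY.cφ⁻ AtY.cψ⁻ blockedAtY j))
      where
      z : Fin 4
      z = punchIn x (σ (σ i))
      Y≢z : Y ≢ z
      Y≢z Y≡z = σ²-no-fixpoint i (sym (punchIn-injective x _ _ Y≡z))
      j : Fin 3
      j = punchOut Y≢z
      ψY∉Lz : ψ Y ∉ L z
      ψY∉Lz ψY∈Lz = σ-not-listed (σ i)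
        (∈-∖⁺ (subst (_∈ L z) (sym (σ-holds i)) ψY∈Lz) (proj₂ (∈-L⁻ (proj₂ cφ⁻ (σ i)))))
      Lz⊆ : L z ⊆ AtY.L⁻ j
      Lz⊆ = subst (λ v → L z ⊆ L v ∖ ψ Y) (sym (punchIn-punchOut Y≢z)) (∉⇒⊆∖ ψY∉Lz)

  via-fresh-colour : ∀ {f} → f ∈ L x → ¬ Uses φ f → Path L φ ψ
  via-fresh-colour {f} f∈Lx f-fresh = finish-at zero (move₁ ◅ move₂ ◅ move₃ ◅ ε) (≔-here Y)
    where
    Y S : Fin 4
    Y = punchIn x zero
    S = punchIn x (σ zero)
    φ₁ : Colouring 4
    φ₁ = φ [ x ≔ f ]
    move₁ : Move L φ φ₁
    move₁ = recolouring L x f∈Lx f-fresh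
    c-fresh : ¬ Uses φ₁ c
    c-fresh = subst (¬_ ∘ Uses φ₁) φx≡ψx (vacated-fresh (colouring-injective cφ) f-fresh x)
    move₂ : Move L φ₁ (φ₁ [ S ≔ c ])
    move₂ = recolouring L S (c-listed (σ zero)) c-fresh
    φ₁S≡ψY : φ₁ S ≡ ψ Y
    φ₁S≡ψY = trans (≔-elsewhere S (punchInᵢ≢i x (σ zero))) (σ-holds zero)
    ψY-fresh : ¬ Uses (φ₁ [ S ≔ c ]) (ψ Y)
    ψY-fresh = subst (¬_ ∘ Uses (φ₁ [ S ≔ c ])) φ₁S≡ψY
      (vacated-fresh (colouring-injective (move-colouring L cφ move₁)) c-fresh S)
    move₃ : Move L (φ₁ [ S ≔ c ]) (φ₁ [ S ≔ c ] [ Y ≔ ψ Y ])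
    move₃ = recolouring L Y (proj₂ cψ Y) ψY-fresh

  via-exchanges : ∀ i → φ (punchIn x i) ∈ L x → φ (punchIn x (σ i)) ∈ L x → Path L φ ψ
  via-exchanges i φY∈Lx φS∈Lx =
    finish-at i (exchanging L S≢x φS∈Lx φx∈LS ◅ exchanging L Y≢x φ₁Y∈Lx φ₁x∈LY ◅ ε) (trans (⇄-left Y≢x) φ₁x≡ψY)
    where
    Y S : Fin 4
    Y = punchIn x i
    S = punchIn x (σ i)
    Y≢x : Y ≢ x
    Y≢x = punchInᵢ≢i x i
    S≢x : S ≢ x
    S≢x = punchInᵢ≢i x (σ i)
    Y≢S : Y ≢ S
    Y≢S Y≡S = σ-no-fixpoint i (sym (punchIn-injective x _ _ Y≡S))
    φx∈LS : φ x ∈ L S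
    φx∈LS = subst (_∈ L S) (sym φx≡ψx) (c-listed (σ i))
    φ₁ : Colouring 4
    φ₁ = φ [ S ⇄ x ]
    φ₁x≡ψY : φ₁ x ≡ ψ Y
    φ₁x≡ψY = trans (⇄-right S x) (σ-holds i)
    φ₁Y∈Lx : φ₁ Y ∈ L x
    φ₁Y∈Lx = subst (_∈ L x) (sym (⇄-elsewhere Y Y≢S Y≢x)) φY∈Lx
    φ₁x∈LY : φ₁ x ∈ L Y
    φ₁x∈LY = subst (_∈ L Y) (sym φ₁x≡ψY) (proj₂ cψ Y)

  Listed : Fin 3 → Set
  Listed i = φ (punchIn x i) ∈ L x

  listed? : ∀ i → Dec (Listed i)
  listed? i = φ (punchIn x i) ∈? L x

  two-listed : All (Uses φ) (L x) → ∃₂ λ p q → p ≢ q × Listed p × Listed q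
  two-listed all-used = pick (filter listed? (allFin 3)) (filter⁺ listed? (allFin⁺ 3)) (proj₂ ∘ ∈-filter⁻ listed?) Lx⊆
    where
    Lx⊆ : L x ⊆ c ∷ map (restrict φ) (filter listed? (allFin 3))
    Lx⊆ e∈Lx with All.lookup all-used e∈Lx
    ... | w , refl with around x w
    ... | centre    = here φx≡ψx
    ... | punched i = there (∈-map⁺ (restrict φ) (∈-filter⁺ listed? (∈-allFin i) e∈Lx))
    pick : ∀ S → Unique S → (∀ {i} → i ∈ S → Listed i) → L x ⊆ c ∷ map (restrict φ) S →
           ∃₂ λ p q → p ≢ q × Listed p × Listed q
    pick []          _               _      Lx⊆ = contradiction (list-long Lx⊆) λ { (s≤s ()) }
    pick (_ ∷ [])    _               _      Lx⊆ = contradiction (list-long Lx⊆) λ { (s≤s (s≤s ())) }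
    pick (p ∷ q ∷ _) ((p≢q ∷ _) ∷ _) listed _   = p , q , p≢q , listed (here refl) , listed (there (here refl))

  no-listed-pair : (∀ i → Listed i → ¬ Listed (σ i)) → ∀ {p q} → p ≢ q → Listed p → Listed q → ⊥
  no-listed-pair unpaired {p} {q} p≢q Lp Lq = 1+n≰n (Unique⇒length≤ {as = p ∷ q ∷ σ p ∷ σ q ∷ []}
    ( (p≢q ∷ apart Lp (unpaired p Lp) ∷ apart Lp (unpaired q Lq) ∷ [])
    ∷ (apart Lq (unpaired p Lp) ∷ apart Lq (unpaired q Lq) ∷ [])
    ∷ ((p≢q ∘ σ-injective) ∷ [])
    ∷ [] ∷ []))
    where
    apart : ∀ {a b} → Listed a → ¬ Listed b → a ≢ b
    apart La ¬Lb refl = ¬Lb La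

  path : Path L φ ψ
  path with All.all? (uses? φ) (L x)
  ... | no ¬all-used with f , f∈Lx , f-fresh ← find (¬All⇒Any¬ (uses? φ) (L x) ¬all-used) = via-fresh-colour f∈Lx f-fresh
  ... | yes all-used with any? (λ i → listed? i ×-dec listed? (σ i))
  ... | yes (i , Li , Lσi) = via-exchanges i Li Lσi
  ... | no ∄pair with p , q , p≢q , Lp , Lq ← two-listed all-used =
    ⊥-elim (no-listed-pair (λ i Li Lσi → ∄pair (i , Li , Lσi)) p≢q Lp Lq)

blocked⇒agreement-or-triangle : ∀ m {L : ListAssignment (suc m)} → IsDegreeAssignment L →
                                ∀ {φ ψ} → IsColouring L φ → IsColouring L ψ → Blocked L φ ψ →
                                Agreement L φ ψ ⊎ (suc m ≡ 3 × Blocked L φ ψ)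
blocked⇒agreement-or-triangle 0 deg cφ cψ blocked =
  contradiction (BlockedAnalysis.3≤n deg cφ cψ blocked zero) λ { (s≤s ()) }
blocked⇒agreement-or-triangle 1 deg cφ cψ blocked =
  contradiction (BlockedAnalysis.3≤n deg cφ cψ blocked zero) λ { (s≤s (s≤s ())) }
blocked⇒agreement-or-triangle 2 deg cφ cψ blocked = inj₂ (refl , blocked)
blocked⇒agreement-or-triangle (suc (suc (suc _))) deg cφ cψ blocked =
  inj₁ (BlockedAnalysis.agreement-from-blocked deg cφ cψ blocked (s≤s (s≤s (s≤s (s≤s z≤n)))) zero)

agreement-or-triangle : ∀ m {L : ListAssignment (suc m)} → IsDegreeAssignment L →
                        ∀ {φ ψ} → IsColouring L φ → IsColouring L ψ →
                        Agreement L φ ψ ⊎ (suc m ≡ 3 × Blocked L φ ψ)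
agreement-or-triangle m deg cφ cψ =
  [ inj₁ , blocked⇒agreement-or-triangle m deg cφ cψ ] (agreement-or-blocked cφ cψ)

connectivity : ∀ n → Connectivity n
connectivity zero    L deg cφ cψ = inj₁ (stay (λ ()) ◅ ε)
connectivity (suc m) L deg {ψ = ψ} cφ cψ with agreement-or-triangle m deg cφ cψ
... | inj₂ triangle = inj₂ triangle
... | inj₁ (agreement x {φ′} p φ′x≡ψx) = inj₁ (p ◅◅ rest)
  where
  module R = Reduction deg (path-colouring L cφ p) cψ x φ′x≡ψx
  rest : Path L φ′ ψ
  rest with connectivity m R.L⁻ R.deg⁻ R.cφ⁻ R.cψ⁻
  ... | inj₁ p⁻ = R.lift p⁻
  ... | inj₂ (refl , blocked⁻) = TriangleCase.path (connectivity 3) deg (path-colouring L cφ p) cψ x φ′x≡ψx blocked⁻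

ExistenceFrom : ℕ → Set
ExistenceFrom n = ∀ {L : ListAssignment n} → IsDegreeAssignment L → ∀ z → n ≤ length (L z) → ∃ (IsColouring L)

colour-first-vertex : ∀ {m} → ExistenceFrom (suc m) → ExistenceFrom (suc (suc m))
colour-first-vertex {m} colour-rest {L} deg z 2+m≤|Lz| = _ , extend-colouring c∈Lx (proj₂ colouring⁻)
  where
  x : Fin (suc (suc m))
  x = punchIn z zero
  x≢z : x ≢ z
  x≢z = punchInᵢ≢i z zero
  c∈L : ∃ (_∈ L x)
  c∈L = ∃-∈ (≤-pred (≤-trans (s≤s (s≤s z≤n)) (proj₂ (deg x))))
  c : Colour
  c = proj₁ c∈L
  c∈Lx : c ∈ L x
  c∈Lx = proj₂ c∈L
  open Deletion L x c
  z⁻ : Fin (suc m)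
  z⁻ = punchOut x≢z
  1+m≤|L⁻z⁻| : suc m ≤ length (L⁻ z⁻)
  1+m≤|L⁻z⁻| = subst (λ v → suc m ≤ length (L v ∖ c)) (sym (punchIn-punchOut x≢z))
    (≤-pred (≤-trans 2+m≤|Lz| (∖-length (proj₁ (deg z)))))
  colouring⁻ : ∃ (IsColouring L⁻)
  colouring⁻ = colour-rest (degree-assignment deg) z⁻ 1+m≤|L⁻z⁻|

colouring-exists : ∀ n → ExistenceFrom n
colouring-exists 0 _ () _
colouring-exists 1 _ zero 1≤|L0| with e , e∈L0 ← ∃-∈ 1≤|L0| =
  (λ _ → e) , (λ { zero zero 0≢0 → contradiction refl 0≢0 }) , λ { zero → e∈L0 }
colouring-exists (suc (suc m)) = colour-first-vertex (colouring-exists (suc m))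

distinguishing-colour : ∀ {A B : List Colour} → ¬ SameSet A B → ∃ λ a → (a ∈ A × a ∉ B) ⊎ (a ∈ B × a ∉ A)
distinguishing-colour {A} {B} A≉B with All.all? (_∈? B) A | All.all? (_∈? A) B
... | yes A⊆B | yes B⊆A = ⊥-elim (A≉B λ a → mk⇔ (All.lookup A⊆B) (All.lookup B⊆A))
... | no A⊈B  | _       with a , a∈A , a∉B ← find (¬All⇒Any¬ (_∈? B) A A⊈B) = a , inj₁ (a∈A , a∉B)
... | yes _   | no B⊈A  with a , a∈B , a∉A ← find (¬All⇒Any¬ (_∈? A) B B⊈A) = a , inj₂ (a∈B , a∉A)

k-assignment⇒degree-assignment : ∀ {k} {L : ListAssignment (suc k)} → IsKAssignment k L → IsDegreeAssignment L
k-assignment⇒degree-assignment kA v = proj₁ (kA v) , s≤s (≤-reflexive (sym (proj₂ (kA v))))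

colouring-avoiding : ∀ {m} {L : ListAssignment (suc m)} → IsDegreeAssignment L →
                     ∀ {v w a} → a ∈ L v → a ∉ L w → ∃ (IsColouring L)
colouring-avoiding {m} {L} deg {v} {w} {a} a∈Lv a∉Lw = _ , extend-colouring a∈Lv (proj₂ colouring⁻)
  where
  open Deletion L v a
  v≢w : v ≢ w
  v≢w refl = a∉Lw a∈Lv
  w⁻ : Fin m
  w⁻ = punchOut v≢w
  m≤|L⁻w⁻| : m ≤ length (L⁻ w⁻)
  m≤|L⁻w⁻| = subst (λ u → m ≤ length (L u ∖ a)) (sym (punchIn-punchOut v≢w))
    (≤-trans (≤-pred (proj₂ (deg w))) (⊆⇒length≤ (proj₁ (deg w)) (∉⇒⊆∖ a∉Lw)))
  colouring⁻ : ∃ (IsColouring L⁻)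
  colouring⁻ = colouring-exists m (degree-assignment deg) w⁻ m≤|L⁻w⁻|

lemma17 : (k : ℕ) → 3 ≤ k → (L : ListAssignment (suc k)) → IsKAssignment k L →
    Σ (Fin (suc k)) (λ v → Σ (Fin (suc k)) (λ w → ¬ SameSet (L v) (L w))) →
    LSwappable (Complete (suc k)) L
lemma17 k 3≤k L kA (v , w , Lv≉Lw) = existence , λ φ ψ cφ cψ → equivalent cφ cψ
  where
  deg : IsDegreeAssignment L
  deg = k-assignment⇒degree-assignment kA
  existence : ∃ (IsColouring L)
  existence with distinguishing-colour Lv≉Lw
  ... | a , inj₁ (a∈Lv , a∉Lw) = colouring-avoiding deg a∈Lv a∉Lw
  ... | a , inj₂ (a∈Lw , a∉Lv) = colouring-avoiding deg a∈Lw a∉Lv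
  equivalent : ∀ {φ ψ} → IsColouring L φ → IsColouring L ψ → LEquivalent (Complete (suc k)) L φ ψ
  equivalent cφ cψ with connectivity (suc k) L deg cφ cψ
  ... | inj₁ p = path⇒LEquivalent L zero cφ p
  ... | inj₂ (refl , _) = contradiction 3≤k λ { (s≤s (s≤s ())) }
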